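{- Let $n\geqslant 4$ and let $H$ be a Hadamard matrix of order $n$. If there exist three distinct rows $i,j,k$ of $H$ such that all the quadruples $\{i,j,k,\ell\}$, with $\ell$ ranging over the rows of $H$ not in $\{i,j,k\}$, have the same type, then $n=4$ or $n=12$.
   Context: A Hadamard matrix of order $n$ is an $n\times n$ matrix $H=(h_{uv})$ with entries in $\{ -1,1\}$ such that $HH^\top=nI$. For four distinct rows $i,j,k,\ell$ of $H$, put $P_{ijk\ell}=\left|\sum_{r=1}^n h_{ir}h_{jr}h_{kr}h_{\ell r}\right|$; the type of the quadruple $\{i,j,k,\ell\}$ is $T_{ijk\ell}=\frac{n-P_{ijk\ell}}{8}$. -}

module Defs where

open import Data.Nat using (ℕ; zero; suc)
open import Data.Integer using (ℤ; +_; -[1+_]; _+_; _*_; ∣_∣) renaming (_-_ to _-ℤ_)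
open import Data.Fin using (Fin; zero; suc; _≟_)
open import Relation.Nullary using (yes; no)
open import Data.Rational using (ℚ; _/_)
open import Data.Sum using (_⊎_)
open import Data.Product using (_×_)
open import Relation.Binary.PropositionalEquality using (_≡_; _≢_)

Σ : (n : ℕ) → (Fin n → ℤ) → ℤ
Σ zero    f = + 0
Σ (suc n) f = f zero + Σ n (λ i → f (suc i))

nI : (n : ℕ) → Fin n → Fin n → ℤ
nI n u v with u ≟ v
... | yes _ = + n
... | no _ = + 0

Matrix : ℕ → Set
Matrix n = Fin n → Fin n → ℤ

record IsHadamard (n : ℕ) (H : Matrix n) : Set where
  field
    entries : ∀ u v → (H u v ≡ + 1) ⊎ (H u v ≡ -[1+ 0 ])
    orthogonal : ∀ u v → Σ n (λ r → H u r * H v r) ≡ nI n u v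

P : (n : ℕ) → Matrix n → Fin n → Fin n → Fin n → Fin n → ℕ
P n H i j k l = ∣ Σ n (λ r → H i r * H j r * H k r * H l r) ∣

T : (n : ℕ) → Matrix n → Fin n → Fin n → Fin n → Fin n → ℚ
T n H i j k l = ((+ n) -ℤ (+ P n H i j k l)) / 8

module Submission where

-- Let τ be the entrywise product of rows i, j, k and S l = Σ_r τ_r h_lr, so that P_{ijkl} = |S l|.
-- Since also HᵀH = nI, Parseval gives Σ_l (S l)² = n Σ_r τ_r² = n². Orthogonality of the rows makes
-- S i = S j = S k = 0, and equal types make |S l| a constant a on the other n − 3 rows, so that
-- n² = (n − 3)a². As n² = (n − 3)(n + 3) + 9, the number n − 3 divides 9, hence n ∈ {4, 6, 12};
-- and n = 6 is impossible because 12 is not a square.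

open import Defs
open import Data.Nat as ℕ using (ℕ; zero; suc; _≤_)
import Data.Nat.Properties as ℕP
open import Data.Nat.Divisibility using (_∣_; _∣?_; m∣m*n; ∣m+n∣m⇒∣n; >⇒∤)
import Data.Nat.Tactic.RingSolver as ℕSolver
open import Data.Integer using (ℤ; +_; _+_; _*_; -_; _-_; ∣_∣; 0ℤ; 1ℤ; -1ℤ; +≤+)
import Data.Integer as ℤ
import Data.Integer.Properties as ℤP
open import Data.Integer.Tactic.RingSolver using (solve-∀)
open import Data.Rational using (_/_)
import Data.Rational.Properties as ℚP
open import Data.Rational.Unnormalised.Base using (mkℚᵘ; *≡*)
open import Data.Fin using (Fin; zero; suc; _≟_)
open import Data.Fin.Properties using (¬∀⟶∃¬)
open import Data.Sum using (_⊎_; inj₁; inj₂; reduce)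
open import Data.Product using (∃-syntax; _×_; _,_; proj₁; proj₂; map₂)
open import Function using (_∘_)
open import Relation.Nullary using (yes; no; ¬_; contradiction)
open import Relation.Nullary.Decidable using (toWitnessFalse)
open import Relation.Binary.PropositionalEquality
open import Algebra.Properties.Semiring.Sum ℤP.+-*-semiring
  using (sum; sum-syntax; sum-cong-≗; sum-replicate-zero; ∑-distrib-+; ∑-comm; *-distribˡ-sum; *-distribʳ-sum)
open import Algebra.Properties.CommutativeSemigroup ℤP.*-commutativeSemigroup using (interchange)
open import Algebra.Properties.AbelianGroup ℤP.+-0-abelianGroup using (∙-cancelˡ; ∙-cancelʳ)
open ≡-Reasoning

Σ≡sum : ∀ n (f : Fin n → ℤ) → Σ n f ≡ sum f
Σ≡sum zero    f = refl
Σ≡sum (suc n) f = cong (_+_ (f zero)) (Σ≡sum n (λ r → f (suc r)))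

∑-const : ∀ n x → ∑[ r < n ] x ≡ + n * x
∑-const zero    x = sym (ℤP.*-zeroˡ x)
∑-const (suc n) x = begin
  x + ∑[ r < n ] x ≡⟨ cong (_+_ x) (∑-const n x) ⟩
  x + + n * x      ≡⟨ ℤP.suc-* (+ n) x ⟨
  + suc n * x      ∎

∑1≡n : ∀ n → ∑[ r < n ] 1ℤ ≡ + n
∑1≡n n = trans (∑-const n 1ℤ) (ℤP.*-identityʳ (+ n))

∑-neg : ∀ {n} (f : Fin n → ℤ) → ∑[ r < n ] (- f r) ≡ - sum f
∑-neg f = begin
  ∑[ r < _ ] (- f r)     ≡⟨ sum-cong-≗ (λ r → ℤP.-1*i≡-i (f r)) ⟨
  ∑[ r < _ ] (-1ℤ * f r) ≡⟨ *-distribˡ-sum -1ℤ f ⟨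
  -1ℤ * sum f            ≡⟨ ℤP.-1*i≡-i (sum f) ⟩
  - sum f                ∎

∑-distrib-minus : ∀ {n} (f g : Fin n → ℤ) → ∑[ r < n ] (f r - g r) ≡ sum f - sum g
∑-distrib-minus f g = trans (∑-distrib-+ f (λ r → - g r)) (cong (_+_ (sum f)) (∑-neg g))

∑*∑ : ∀ {m n} (f : Fin m → ℤ) (g : Fin n → ℤ) →
      sum f * sum g ≡ ∑[ a < m ] ∑[ b < n ] (f a * g b)
∑*∑ f g = trans (*-distribʳ-sum (sum g) f) (sum-cong-≗ (λ a → *-distribˡ-sum (f a) g))

∑∑ : ∀ {m n} → (Fin m → Fin n → ℤ) → ℤ
∑∑ {m} {n} F = ∑[ a < m ] ∑[ b < n ] F a b

∑∑-cong : ∀ {m n} {F G : Fin m → Fin n → ℤ} → (∀ a b → F a b ≡ G a b) → ∑∑ F ≡ ∑∑ G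
∑∑-cong F≡G = sum-cong-≗ (λ a → sum-cong-≗ (F≡G a))

∑∑-distrib-+ : ∀ {m n} (F G : Fin m → Fin n → ℤ) →
               ∑∑ (λ a b → F a b + G a b) ≡ ∑∑ F + ∑∑ G
∑∑-distrib-+ F G =
  trans (sum-cong-≗ (λ a → ∑-distrib-+ (F a) (G a))) (∑-distrib-+ (λ a → sum (F a)) (λ a → sum (G a)))

∑∑-comm : ∀ {m n} (F : Fin m → Fin m → Fin n → Fin n → ℤ) →
          ∑∑ (λ a b → ∑∑ (F a b)) ≡ ∑∑ (λ c d → ∑∑ (λ a b → F a b c d))
∑∑-comm {m} {n} F = begin
  ∑[ a < m ] ∑[ b < m ] ∑[ c < n ] ∑[ d < n ] F a b c d
    ≡⟨ sum-cong-≗ (λ a → ∑-comm (λ b c → ∑[ d < n ] F a b c d)) ⟩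
  ∑[ a < m ] ∑[ c < n ] ∑[ b < m ] ∑[ d < n ] F a b c d
    ≡⟨ ∑-comm (λ a c → ∑[ b < m ] ∑[ d < n ] F a b c d) ⟩
  ∑[ c < n ] ∑[ a < m ] ∑[ b < m ] ∑[ d < n ] F a b c d
    ≡⟨ sum-cong-≗ (λ c → sum-cong-≗ (λ a → ∑-comm (λ b d → F a b c d))) ⟩
  ∑[ c < n ] ∑[ a < m ] ∑[ d < n ] ∑[ b < m ] F a b c d
    ≡⟨ sum-cong-≗ (λ c → ∑-comm (λ a d → ∑[ b < m ] F a b c d)) ⟩
  ∑[ c < n ] ∑[ d < n ] ∑[ a < m ] ∑[ b < m ] F a b c d ∎

δ : ∀ {n} → Fin n → Fin n → ℤ
δ zero    zero    = 1ℤ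
δ zero    (suc _) = 0ℤ
δ (suc _) zero    = 0ℤ
δ (suc u) (suc v) = δ u v

δ-diag : ∀ {n} (u : Fin n) → δ u u ≡ 1ℤ
δ-diag zero    = refl
δ-diag (suc u) = δ-diag u

δ-off : ∀ {n} {u v : Fin n} → u ≢ v → δ u v ≡ 0ℤ
δ-off {u = zero}  {zero}  u≢v = contradiction refl u≢v
δ-off {u = zero}  {suc v} _   = refl
δ-off {u = suc u} {zero}  _   = refl
δ-off {u = suc u} {suc v} u≢v = δ-off (u≢v ∘ cong suc)

nI≡n*δ : ∀ n (u v : Fin n) → nI n u v ≡ + n * δ u v
nI≡n*δ n u v with u ≟ v
... | yes refl = sym (trans (cong (+ n *_) (δ-diag u)) (ℤP.*-identityʳ (+ n)))
... | no u≢v   = sym (trans (cong (+ n *_) (δ-off u≢v)) (ℤP.*-zeroʳ (+ n)))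

∑-δ : ∀ {n} (f : Fin n → ℤ) u → ∑[ v < n ] (f v * δ u v) ≡ f u
∑-δ {suc n} f zero = begin
  f zero * 1ℤ + ∑[ v < n ] (f (suc v) * 0ℤ) ≡⟨ cong₂ _+_ (ℤP.*-identityʳ (f zero)) ∑0≡0 ⟩
  f zero + 0ℤ                              ≡⟨ ℤP.+-identityʳ (f zero) ⟩
  f zero                                   ∎
  where
  ∑0≡0 : ∑[ v < n ] (f (suc v) * 0ℤ) ≡ 0ℤ
  ∑0≡0 = trans (sum-cong-≗ (λ v → ℤP.*-zeroʳ (f (suc v)))) (sum-replicate-zero n)
∑-δ {suc n} f (suc u) = begin
  f zero * 0ℤ + ∑[ v < n ] (f (suc v) * δ u v) ≡⟨ cong₂ _+_ (ℤP.*-zeroʳ (f zero)) (∑-δ (f ∘ suc) u) ⟩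
  0ℤ + f (suc u)                               ≡⟨ ℤP.+-identityˡ (f (suc u)) ⟩
  f (suc u)                                    ∎

∑∑-*δ : ∀ {n} c (F : Fin n → Fin n → ℤ) → ∑∑ (λ r s → F r s * (c * δ r s)) ≡ c * ∑[ r < n ] F r r
∑∑-*δ c F = begin
  ∑∑ (λ r s → F r s * (c * δ r s)) ≡⟨ ∑∑-cong (λ r s → regroup (F r s) c (δ r s)) ⟩
  ∑∑ (λ r s → (c * F r s) * δ r s) ≡⟨ sum-cong-≗ (λ r → ∑-δ (λ s → c * F r s) r) ⟩
  ∑[ r < _ ] (c * F r r)           ≡⟨ *-distribˡ-sum c (λ r → F r r) ⟨
  c * ∑[ r < _ ] F r r             ∎
  where
  regroup : ∀ x c d → x * (c * d) ≡ (c * x) * d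
  regroup = solve-∀

i*i≡+∣i∣*∣i∣ : ∀ i → i * i ≡ + (∣ i ∣ ℕ.* ∣ i ∣)
i*i≡+∣i∣*∣i∣ (+ zero)   = refl
i*i≡+∣i∣*∣i∣ (+ suc _)  = refl
i*i≡+∣i∣*∣i∣ ℤ.-[1+ _ ] = refl

0≤i*i : ∀ i → 0ℤ ℤ.≤ i * i
0≤i*i i = subst (0ℤ ℤ.≤_) (sym (i*i≡+∣i∣*∣i∣ i)) (+≤+ ℕ.z≤n)

i*i≡0⇒i≡0 : ∀ {i} → i * i ≡ 0ℤ → i ≡ 0ℤ
i*i≡0⇒i≡0 {i} e = reduce (ℤP.i*j≡0⇒i≡0∨j≡0 i e)

+-nonneg≡0 : ∀ {a b} → 0ℤ ℤ.≤ a → 0ℤ ℤ.≤ b → a + b ≡ 0ℤ → a ≡ 0ℤ × b ≡ 0ℤ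
+-nonneg≡0 {+ m} {+ k} _ _ e =
  cong +_ (ℕP.m+n≡0⇒m≡0 m (ℤP.+-injective e)) , cong +_ (ℕP.m+n≡0⇒n≡0 m (ℤP.+-injective e))

∑-nonneg : ∀ {n} {f : Fin n → ℤ} → (∀ r → 0ℤ ℤ.≤ f r) → 0ℤ ℤ.≤ sum f
∑-nonneg {zero}  _   = ℤP.≤-refl
∑-nonneg {suc n} 0≤f = ℤP.+-mono-≤ (0≤f zero) (∑-nonneg (0≤f ∘ suc))

∑-nonneg≡0 : ∀ {n} {f : Fin n → ℤ} → (∀ r → 0ℤ ℤ.≤ f r) → sum f ≡ 0ℤ → ∀ r → f r ≡ 0ℤ
∑-nonneg≡0 {suc n} 0≤f e zero    = proj₁ (+-nonneg≡0 (0≤f zero) (∑-nonneg (0≤f ∘ suc)) e)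
∑-nonneg≡0 {suc n} 0≤f e (suc r) =
  ∑-nonneg≡0 (0≤f ∘ suc) (proj₂ (+-nonneg≡0 (0≤f zero) (∑-nonneg (0≤f ∘ suc)) e)) r

∑∑-squares≡0 : ∀ {m n} (X : Fin m → Fin n → ℤ) →
               ∑∑ (λ a b → X a b * X a b) ≡ 0ℤ → ∀ a b → X a b ≡ 0ℤ
∑∑-squares≡0 X e a b = i*i≡0⇒i≡0 (∑-nonneg≡0 (λ b → 0≤i*i (X a b)) row-a≡0 b)
  where
  row-a≡0 = ∑-nonneg≡0 (λ a → ∑-nonneg (λ b → 0≤i*i (X a b))) e a

∑∑-inner⇒≡ : ∀ {m n} (F G : Fin m → Fin n → ℤ) {c} →
             ∑∑ (λ a b → F a b * F a b) ≡ c → ∑∑ (λ a b → F a b * G a b) ≡ c →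
             ∑∑ (λ a b → G a b * G a b) ≡ c → ∀ a b → F a b ≡ G a b
∑∑-inner⇒≡ {m} {n} F G {c} ∑∑FF ∑∑FG ∑∑GG a b =
  ℤP.i-j≡0⇒i≡j _ _ (∑∑-squares≡0 (λ a b → F a b - G a b) ∑∑[F-G]²≡0 a b)
  where
  [F-G]² FG FF+GG : Fin m → Fin n → ℤ
  [F-G]² a b = (F a b - G a b) * (F a b - G a b)
  FG     a b = F a b * G a b
  FF+GG  a b = F a b * F a b + G a b * G a b

  expansion : ∀ f g → (f - g) * (f - g) + (f * g + f * g) ≡ f * f + g * g
  expansion = solve-∀

  ∑∑[F-G]²≡0 : ∑∑ [F-G]² ≡ 0ℤ
  ∑∑[F-G]²≡0 = ∙-cancelʳ (c + c) _ 0ℤ (begin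
    ∑∑ [F-G]² + (c + c)
      ≡⟨ cong (λ x → ∑∑ [F-G]² + (x + x)) ∑∑FG ⟨
    ∑∑ [F-G]² + (∑∑ FG + ∑∑ FG)
      ≡⟨ cong (_+_ (∑∑ [F-G]²)) (∑∑-distrib-+ FG FG) ⟨
    ∑∑ [F-G]² + ∑∑ (λ a b → FG a b + FG a b)
      ≡⟨ ∑∑-distrib-+ [F-G]² (λ a b → FG a b + FG a b) ⟨
    ∑∑ (λ a b → [F-G]² a b + (FG a b + FG a b))
      ≡⟨ ∑∑-cong (λ a b → expansion (F a b) (G a b)) ⟩
    ∑∑ FF+GG
      ≡⟨ ∑∑-distrib-+ (λ a b → F a b * F a b) (λ a b → G a b * G a b) ⟩
    ∑∑ (λ a b → F a b * F a b) + ∑∑ (λ a b → G a b * G a b)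
      ≡⟨ cong₂ _+_ ∑∑FF ∑∑GG ⟩
    c + c
      ≡⟨ ℤP.+-identityˡ (c + c) ⟨
    0ℤ + (c + c) ∎)

module _ {m n : ℕ} (A : Fin m → Fin n → ℤ) where

  rowGram : Fin m → Fin m → ℤ
  rowGram l l′ = ∑[ r < n ] (A l r * A l′ r)

  colGram : Fin n → Fin n → ℤ
  colGram r s = ∑[ l < m ] (A l r * A l s)

  mulVec : (Fin n → ℤ) → Fin m → ℤ
  mulVec v l = ∑[ r < n ] (v r * A l r)

  ∑∑-colGram²≡∑∑-rowGram² :
    ∑∑ (λ r s → colGram r s * colGram r s) ≡ ∑∑ (λ l l′ → rowGram l l′ * rowGram l l′)
  ∑∑-colGram²≡∑∑-rowGram² = begin
    ∑∑ (λ r s → colGram r s * colGram r s)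
      ≡⟨ ∑∑-cong (λ r s → ∑*∑ (λ l → A l r * A l s) (λ l′ → A l′ r * A l′ s)) ⟩
    ∑∑ (λ r s → ∑∑ (λ l l′ → (A l r * A l s) * (A l′ r * A l′ s)))
      ≡⟨ ∑∑-comm (λ r s l l′ → (A l r * A l s) * (A l′ r * A l′ s)) ⟩
    ∑∑ (λ l l′ → ∑∑ (λ r s → (A l r * A l s) * (A l′ r * A l′ s)))
      ≡⟨ ∑∑-cong (λ l l′ → ∑∑-cong (λ r s → interchange (A l r) (A l s) (A l′ r) (A l′ s))) ⟩
    ∑∑ (λ l l′ → ∑∑ (λ r s → (A l r * A l′ r) * (A l s * A l′ s)))
      ≡⟨ ∑∑-cong (λ l l′ → ∑*∑ (λ r → A l r * A l′ r) (λ s → A l s * A l′ s)) ⟨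
    ∑∑ (λ l l′ → rowGram l l′ * rowGram l l′) ∎

  ∑-mulVec² : ∀ v → ∑[ l < m ] (mulVec v l * mulVec v l) ≡ ∑∑ (λ r s → (v r * v s) * colGram r s)
  ∑-mulVec² v = begin
    ∑[ l < m ] (mulVec v l * mulVec v l)
      ≡⟨ sum-cong-≗ (λ l → ∑*∑ (λ r → v r * A l r) (λ s → v s * A l s)) ⟩
    ∑[ l < m ] ∑∑ (λ r s → (v r * A l r) * (v s * A l s))
      ≡⟨ ∑-comm (λ l r → ∑[ s < n ] ((v r * A l r) * (v s * A l s))) ⟩
    ∑[ r < n ] ∑[ l < m ] ∑[ s < n ] ((v r * A l r) * (v s * A l s))
      ≡⟨ sum-cong-≗ (λ r → ∑-comm (λ l s → (v r * A l r) * (v s * A l s))) ⟩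
    ∑∑ (λ r s → ∑[ l < m ] ((v r * A l r) * (v s * A l s)))
      ≡⟨ ∑∑-cong (λ r s → sum-cong-≗ (λ l → interchange (v r) (A l r) (v s) (A l s))) ⟩
    ∑∑ (λ r s → ∑[ l < m ] ((v r * v s) * (A l r * A l s)))
      ≡⟨ ∑∑-cong (λ r s → *-distribˡ-sum (v r * v s) (λ l → A l r * A l s)) ⟨
    ∑∑ (λ r s → (v r * v s) * colGram r s) ∎

module Hadamard {n : ℕ} {H : Matrix n} (isH : IsHadamard n H) where
  open IsHadamard isH

  nδ : Fin n → Fin n → ℤ
  nδ r s = + n * δ r s

  n³ : ℤ
  n³ = + n * (+ n * + n)

  entry² : ∀ u r → H u r * H u r ≡ 1ℤ
  entry² u r with entries u r
  ... | inj₁ e = cong (λ x → x * x) e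
  ... | inj₂ e = cong (λ x → x * x) e

  rowGram≡nδ : ∀ u v → rowGram H u v ≡ nδ u v
  rowGram≡nδ u v = trans (sym (Σ≡sum n _)) (trans (orthogonal u v) (nI≡n*δ n u v))

  rowGram-off : ∀ {u v} → u ≢ v → rowGram H u v ≡ 0ℤ
  rowGram-off {u} {v} u≢v = begin
    rowGram H u v ≡⟨ rowGram≡nδ u v ⟩
    + n * δ u v   ≡⟨ cong (+ n *_) (δ-off u≢v) ⟩
    + n * 0ℤ      ≡⟨ ℤP.*-zeroʳ (+ n) ⟩
    0ℤ            ∎

  colGram-diag : ∀ r → colGram H r r ≡ + n
  colGram-diag r = trans (sum-cong-≗ (λ l → entry² l r)) (∑1≡n n)

  ∑∑-nδ² : ∑∑ (λ r s → nδ r s * nδ r s) ≡ n³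
  ∑∑-nδ² = begin
    ∑∑ (λ r s → nδ r s * nδ r s)
      ≡⟨ ∑∑-*δ (+ n) nδ ⟩
    + n * ∑[ r < n ] (+ n * δ r r)
      ≡⟨ cong (+ n *_) (sum-cong-≗ {n} (λ r → cong (+ n *_) (δ-diag r))) ⟩
    + n * ∑[ r < n ] (+ n * 1ℤ)
      ≡⟨ cong (+ n *_) (∑-const n (+ n * 1ℤ)) ⟩
    + n * (+ n * (+ n * 1ℤ))
      ≡⟨ cong (λ x → + n * (+ n * x)) (ℤP.*-identityʳ (+ n)) ⟩
    n³ ∎

  ∑∑-colGram*nδ : ∑∑ (λ r s → colGram H r s * nδ r s) ≡ n³
  ∑∑-colGram*nδ = begin
    ∑∑ (λ r s → colGram H r s * nδ r s)
      ≡⟨ ∑∑-*δ (+ n) (colGram H) ⟩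
    + n * ∑[ r < n ] colGram H r r
      ≡⟨ cong (+ n *_) (trans (sum-cong-≗ colGram-diag) (∑-const n (+ n))) ⟩
    n³ ∎

  ∑∑-colGram² : ∑∑ (λ r s → colGram H r s * colGram H r s) ≡ n³
  ∑∑-colGram² = begin
    ∑∑ (λ r s → colGram H r s * colGram H r s)
      ≡⟨ ∑∑-colGram²≡∑∑-rowGram² H ⟩
    ∑∑ (λ u v → rowGram H u v * rowGram H u v)
      ≡⟨ ∑∑-cong (λ u v → cong₂ _*_ (rowGram≡nδ u v) (rowGram≡nδ u v)) ⟩
    ∑∑ (λ u v → nδ u v * nδ u v)
      ≡⟨ ∑∑-nδ² ⟩
    n³ ∎

  -- HHᵀ = nI forces HᵀH = nI, as ‖HᵀH − nI‖² = tr((HHᵀ)²) − 2n tr(HᵀH) + n³ = n³ − 2n³ + n³.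
  colGram≡nδ : ∀ r s → colGram H r s ≡ nδ r s
  colGram≡nδ = ∑∑-inner⇒≡ (colGram H) nδ ∑∑-colGram² ∑∑-colGram*nδ ∑∑-nδ²

  parseval : ∀ v → ∑[ l < n ] (mulVec H v l * mulVec H v l) ≡ + n * ∑[ r < n ] (v r * v r)
  parseval v = begin
    ∑[ l < n ] (mulVec H v l * mulVec H v l)
      ≡⟨ ∑-mulVec² H v ⟩
    ∑∑ (λ r s → (v r * v s) * colGram H r s)
      ≡⟨ ∑∑-cong (λ r s → cong (v r * v s *_) (colGram≡nδ r s)) ⟩
    ∑∑ (λ r s → (v r * v s) * nδ r s)
      ≡⟨ ∑∑-*δ (+ n) (λ r s → v r * v s) ⟩
    + n * ∑[ r < n ] (v r * v r) ∎

/-injectiveˡ : ∀ {d} p q → p / suc d ≡ q / suc d → p ≡ q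
/-injectiveˡ {d} p q eq with ℚP./-injective-≃ (mkℚᵘ p d) (mkℚᵘ q d) eq
... | *≡* p*d≡q*d = ℤP.*-cancelʳ-≡ p q (+ suc d) p*d≡q*d

[n-p]/8-injective : ∀ n {p q} → (+ n - + p) / 8 ≡ (+ n - + q) / 8 → p ≡ q
[n-p]/8-injective n eq = ℤP.+-injective (ℤP.neg-injective (∙-cancelˡ (+ n) _ _ (/-injectiveˡ _ _ eq)))

module ThreeRows {n : ℕ} {H : Matrix n} (isH : IsHadamard n H)
                 {i j k : Fin n} (i≢j : i ≢ j) (i≢k : i ≢ k) (j≢k : j ≢ k) where
  open Hadamard isH

  τ : Fin n → ℤ
  τ r = H i r * H j r * H k r

  S : Fin n → ℤ
  S = mulVec H τ

  P≡∣S∣ : ∀ l → P n H i j k l ≡ ∣ S l ∣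
  P≡∣S∣ l = cong ∣_∣ (Σ≡sum n _)

  τ² : ∀ r → τ r * τ r ≡ 1ℤ
  τ² r = begin
    τ r * τ r
      ≡⟨ regroup (H i r) (H j r) (H k r) ⟩
    (H i r * H i r) * ((H j r * H j r) * (H k r * H k r))
      ≡⟨ cong₂ _*_ (entry² i r) (cong₂ _*_ (entry² j r) (entry² k r)) ⟩
    1ℤ ∎
    where
    regroup : ∀ a b c → (a * b * c) * (a * b * c) ≡ (a * a) * ((b * b) * (c * c))
    regroup = solve-∀

  ∑S²≡n² : ∑[ l < n ] (S l * S l) ≡ + n * + n
  ∑S²≡n² = trans (parseval τ) (cong (+ n *_) (trans (sum-cong-≗ τ²) (∑1≡n n)))

  S-vanishes : ∀ {l p q} → p ≢ q → (∀ r → τ r * H l r ≡ (H l r * H l r) * (H p r * H q r)) → S l ≡ 0ℤ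
  S-vanishes {l} {p} {q} p≢q regroup = begin
    S l
      ≡⟨ sum-cong-≗ (λ r → trans (regroup r) (cong (_* (H p r * H q r)) (entry² l r))) ⟩
    ∑[ r < n ] (1ℤ * (H p r * H q r))
      ≡⟨ sum-cong-≗ (λ r → ℤP.*-identityˡ (H p r * H q r)) ⟩
    rowGram H p q
      ≡⟨ rowGram-off p≢q ⟩
    0ℤ ∎

  S-i : S i ≡ 0ℤ
  S-i = S-vanishes j≢k (λ r → regroup (H i r) (H j r) (H k r))
    where
    regroup : ∀ a b c → a * b * c * a ≡ (a * a) * (b * c)
    regroup = solve-∀

  S-j : S j ≡ 0ℤ
  S-j = S-vanishes i≢k (λ r → regroup (H i r) (H j r) (H k r))
    where
    regroup : ∀ a b c → a * b * c * b ≡ (b * b) * (a * c)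
    regroup = solve-∀

  S-k : S k ≡ 0ℤ
  S-k = S-vanishes i≢j (λ r → regroup (H i r) (H j r) (H k r))
    where
    regroup : ∀ a b c → a * b * c * c ≡ (c * c) * (a * b)
    regroup = solve-∀

  outside : Fin n → ℤ
  outside l = 1ℤ - (δ i l + δ j l + δ k l)

  outside-i : outside i ≡ 0ℤ
  outside-i rewrite δ-diag i | δ-off (i≢j ∘ sym) | δ-off (i≢k ∘ sym) = refl

  outside-j : outside j ≡ 0ℤ
  outside-j rewrite δ-off i≢j | δ-diag j | δ-off (j≢k ∘ sym) = refl

  outside-k : outside k ≡ 0ℤ
  outside-k rewrite δ-off i≢k | δ-off j≢k | δ-diag k = refl

  outside-else : ∀ {l} → l ≢ i → l ≢ j → l ≢ k → outside l ≡ 1ℤ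
  outside-else l≢i l≢j l≢k rewrite δ-off (l≢i ∘ sym) | δ-off (l≢j ∘ sym) | δ-off (l≢k ∘ sym) = refl

  ∑-outside : sum outside ≡ + n - + 3
  ∑-outside = begin
    sum outside
      ≡⟨ ∑-distrib-minus (λ _ → 1ℤ) (λ l → δ i l + δ j l + δ k l) ⟩
    ∑[ l < n ] 1ℤ - ∑[ l < n ] (δ i l + δ j l + δ k l)
      ≡⟨ cong₂ _-_ (∑1≡n n) ∑δ₃ ⟩
    + n - + 3 ∎
    where
    ∑δ : ∀ u → ∑[ l < n ] δ u l ≡ 1ℤ
    ∑δ u = trans (sum-cong-≗ (λ l → sym (ℤP.*-identityˡ (δ u l)))) (∑-δ (λ _ → 1ℤ) u)

    ∑δ₃ : ∑[ l < n ] (δ i l + δ j l + δ k l) ≡ + 3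
    ∑δ₃ = begin
      ∑[ l < n ] (δ i l + δ j l + δ k l)
        ≡⟨ ∑-distrib-+ (λ l → δ i l + δ j l) (δ k) ⟩
      ∑[ l < n ] (δ i l + δ j l) + ∑[ l < n ] δ k l
        ≡⟨ cong (_+ _) (∑-distrib-+ (δ i) (δ j)) ⟩
      ∑[ l < n ] δ i l + ∑[ l < n ] δ j l + ∑[ l < n ] δ k l
        ≡⟨ cong₂ _+_ (cong₂ _+_ (∑δ i) (∑δ j)) (∑δ k) ⟩
      + 3 ∎

  outside≢0⇒distinct : ∀ {l} → outside l ≢ 0ℤ → l ≢ i × l ≢ j × l ≢ k
  outside≢0⇒distinct outside≢0 =
      (λ { refl → outside≢0 outside-i })
    , (λ { refl → outside≢0 outside-j })
    , (λ { refl → outside≢0 outside-k })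

  ∃-outside : + n - + 3 ≢ 0ℤ → ∃[ l ] (l ≢ i × l ≢ j × l ≢ k)
  ∃-outside n≢3 =
    map₂ outside≢0⇒distinct (¬∀⟶∃¬ n (λ l → outside l ≡ 0ℤ) (λ l → outside l ℤ.≟ 0ℤ) not-all-zero)
    where
    not-all-zero : ¬ (∀ l → outside l ≡ 0ℤ)
    not-all-zero outside≡0 =
      n≢3 (trans (sym ∑-outside) (trans (sum-cong-≗ outside≡0) (sum-replicate-zero n)))

  S²≡outside*q-at-zero : ∀ {l} q → S l ≡ 0ℤ → outside l ≡ 0ℤ → S l * S l ≡ outside l * q
  S²≡outside*q-at-zero q S≡0 outside≡0 rewrite S≡0 | outside≡0 = sym (ℤP.*-zeroˡ q)

  module _ {a : ℕ} (∣S∣≡a : ∀ l → l ≢ i → l ≢ j → l ≢ k → ∣ S l ∣ ≡ a) where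

    S²≡outside*a² : ∀ l → S l * S l ≡ outside l * + (a ℕ.* a)
    S²≡outside*a² l with l ≟ i | l ≟ j | l ≟ k
    ... | yes refl | _        | _        = S²≡outside*q-at-zero _ S-i outside-i
    ... | no _     | yes refl | _        = S²≡outside*q-at-zero _ S-j outside-j
    ... | no _     | no _     | yes refl = S²≡outside*q-at-zero _ S-k outside-k
    ... | no l≢i   | no l≢j   | no l≢k   = begin
      S l * S l               ≡⟨ i*i≡+∣i∣*∣i∣ (S l) ⟩
      + (∣ S l ∣ ℕ.* ∣ S l ∣) ≡⟨ cong (λ x → + (x ℕ.* x)) (∣S∣≡a l l≢i l≢j l≢k) ⟩
      + (a ℕ.* a)             ≡⟨ ℤP.*-identityˡ (+ (a ℕ.* a)) ⟨
      1ℤ * + (a ℕ.* a)        ≡⟨ cong (_* + (a ℕ.* a)) (outside-else l≢i l≢j l≢k) ⟨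
      outside l * + (a ℕ.* a) ∎

    n²≡[n-3]a² : + n * + n ≡ (+ n - + 3) * + (a ℕ.* a)
    n²≡[n-3]a² = begin
      + n * + n                            ≡⟨ ∑S²≡n² ⟨
      ∑[ l < n ] (S l * S l)               ≡⟨ sum-cong-≗ S²≡outside*a² ⟩
      ∑[ l < n ] (outside l * + (a ℕ.* a)) ≡⟨ *-distribʳ-sum (+ (a ℕ.* a)) outside ⟨
      sum outside * + (a ℕ.* a)            ≡⟨ cong (_* + (a ℕ.* a)) ∑-outside ⟩
      (+ n - + 3) * + (a ℕ.* a)            ∎

  module _ (equalTypes : ∀ l l′ → l ≢ i → l ≢ j → l ≢ k → l′ ≢ i → l′ ≢ j → l′ ≢ k →
                          T n H i j k l ≡ T n H i j k l′) where

    n²≡[n-3]P² : ∀ {l₀} → l₀ ≢ i → l₀ ≢ j → l₀ ≢ k →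
                 + n * + n ≡ (+ n - + 3) * + (P n H i j k l₀ ℕ.* P n H i j k l₀)
    n²≡[n-3]P² {l₀} l₀≢i l₀≢j l₀≢k = n²≡[n-3]a² ∣S∣≡P
      where
      ∣S∣≡P : ∀ l → l ≢ i → l ≢ j → l ≢ k → ∣ S l ∣ ≡ P n H i j k l₀
      ∣S∣≡P l l≢i l≢j l≢k = begin
        ∣ S l ∣        ≡⟨ P≡∣S∣ l ⟨
        P n H i j k l  ≡⟨ [n-p]/8-injective n (equalTypes l l₀ l≢i l≢j l≢k l₀≢i l₀≢j l₀≢k) ⟩
        P n H i j k l₀ ∎

+*+-injective : ∀ {a b c d} → + a * + b ≡ + c * + d → a ℕ.* b ≡ c ℕ.* d
+*+-injective {a} {b} {c} {d} e = ℤP.+-injective (trans (ℤP.pos-* a b) (trans e (sym (ℤP.pos-* c d))))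

divisors-of-9 : ∀ {d} → d ∣ 9 → d ≡ 1 ⊎ d ≡ 3 ⊎ d ≡ 9
divisors-of-9 {0} d∣9 = contradiction d∣9 (toWitnessFalse {a? = 0 ∣? 9} _)
divisors-of-9 {1} _   = inj₁ refl
divisors-of-9 {2} d∣9 = contradiction d∣9 (toWitnessFalse {a? = 2 ∣? 9} _)
divisors-of-9 {3} _   = inj₂ (inj₁ refl)
divisors-of-9 {4} d∣9 = contradiction d∣9 (toWitnessFalse {a? = 4 ∣? 9} _)
divisors-of-9 {5} d∣9 = contradiction d∣9 (toWitnessFalse {a? = 5 ∣? 9} _)
divisors-of-9 {6} d∣9 = contradiction d∣9 (toWitnessFalse {a? = 6 ∣? 9} _)
divisors-of-9 {7} d∣9 = contradiction d∣9 (toWitnessFalse {a? = 7 ∣? 9} _)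
divisors-of-9 {8} d∣9 = contradiction d∣9 (toWitnessFalse {a? = 8 ∣? 9} _)
divisors-of-9 {9} _   = inj₂ (inj₂ refl)
divisors-of-9 {suc (suc (suc (suc (suc (suc (suc (suc (suc (suc d)))))))))} d∣9 =
  contradiction d∣9 (>⇒∤ (ℕP.m≤m+n 10 d))

3*a²≢36 : ∀ a → 3 ℕ.* (a ℕ.* a) ≢ 36
3*a²≢36 0 ()
3*a²≢36 1 ()
3*a²≢36 2 ()
3*a²≢36 3 ()
3*a²≢36 a@(suc (suc (suc (suc b)))) eq =
  contradiction (subst (48 ≤_) eq 48≤3a²) (toWitnessFalse {a? = 48 ℕ.≤? 36} _)
  where
  4≤a : 4 ≤ a
  4≤a = ℕP.m≤m+n 4 b
  48≤3a² : 48 ≤ 3 ℕ.* (a ℕ.* a)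
  48≤3a² = ℕP.*-monoʳ-≤ 3 (ℕP.*-mono-≤ 4≤a 4≤a)

∣[3+d]²⇒∣9 : ∀ {d} → d ∣ (3 ℕ.+ d) ℕ.* (3 ℕ.+ d) → d ∣ 9
∣[3+d]²⇒∣9 {d} d∣[3+d]² = ∣m+n∣m⇒∣n (subst (d ∣_) (expand d) d∣[3+d]²) (m∣m*n (d ℕ.+ 6))
  where
  expand : ∀ d → (3 ℕ.+ d) ℕ.* (3 ℕ.+ d) ≡ d ℕ.* (d ℕ.+ 6) ℕ.+ 9
  expand = ℕSolver.solve-∀

[3+d]²≡d*a²⇒d≡1⊎d≡9 : ∀ d a → (3 ℕ.+ d) ℕ.* (3 ℕ.+ d) ≡ d ℕ.* (a ℕ.* a) → d ≡ 1 ⊎ d ≡ 9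
[3+d]²≡d*a²⇒d≡1⊎d≡9 d a eq with divisors-of-9 (∣[3+d]²⇒∣9 (subst (d ∣_) (sym eq) (m∣m*n (a ℕ.* a))))
... | inj₁ d≡1         = inj₁ d≡1
... | inj₂ (inj₁ refl) = contradiction (sym eq) (3*a²≢36 a)
... | inj₂ (inj₂ d≡9)  = inj₂ d≡9

corollary2p4 : (n : ℕ) → 4 ≤ n → (H : Matrix n) → IsHadamard n H →
    (∃[ i ] ∃[ j ] ∃[ k ] (i ≢ j × i ≢ k × j ≢ k ×
      (∀ l l′ → l ≢ i → l ≢ j → l ≢ k → l′ ≢ i → l′ ≢ j → l′ ≢ k →
        T n H i j k l ≡ T n H i j k l′))) →
    (n ≡ 4) ⊎ (n ≡ 12)
corollary2p4 zero                   ()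
corollary2p4 (suc zero)             (ℕ.s≤s ())
corollary2p4 (suc (suc zero))       (ℕ.s≤s (ℕ.s≤s ()))
corollary2p4 (suc (suc (suc zero))) (ℕ.s≤s (ℕ.s≤s (ℕ.s≤s ())))
corollary2p4 (suc (suc (suc (suc m)))) _ H isH (i , j , k , i≢j , i≢k , j≢k , equalTypes) =
  let open ThreeRows isH i≢j i≢k j≢k
      (l₀ , l₀≢i , l₀≢j , l₀≢k) = ∃-outside (λ ())
      a = P _ H i j k l₀
      n²≡d*a² = +*+-injective {4 ℕ.+ m} {4 ℕ.+ m} {suc m} {a ℕ.* a}
                  (n²≡[n-3]P² equalTypes l₀≢i l₀≢j l₀≢k)
  in  Data.Sum.map (cong (3 ℕ.+_)) (cong (3 ℕ.+_)) ([3+d]²≡d*a²⇒d≡1⊎d≡9 (suc m) a n²≡d*a²)
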